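{- Let $q \geq 2$, $r \geq 0$ be integers, let $G$ be an abelian group (written multiplicatively), and let $I_1, I_2, I_3 \subset \mathbb{N}_0$ be sets, each a union of intervals of length $\geq r$, such that $\mathbb{N}_0$ is the disjoint union $I_1 \cup I_2 \cup I_3$. Then for every $f \in \mathrm{SM}_q^r(G)$ and every $n \geq 0$, \[ f(n) = f(n|_{I_1 \cup I_2})\, f(n|_{I_2 \cup I_3})\, f(n|_{I_3 \cup I_1})\, f(n|_{I_1})^{ -1} f(n|_{I_2})^{ -1} f(n|_{I_3})^{ -1}. \]
   Context: For an integer $n \geq 0$ with base-$q$ expansion $n = \sum_{j \geq 0} d_j q^j$ ($d_j \in \{0,\dots,q-1\}$) and a set $I \subset \mathbb{N}_0$, write $n|_I = \sum_{j \in I} d_j q^j$ (all digits outside $I$ replaced by $0$). $\mathrm{SM}_q^r(G)$ denotes the set of sequences $f \colon \mathbb{N}_0 \to G$ with $f(0) = \mathrm{id}_G$ such that $f(n+m+k) = f(n+m) f(m)^{ -1} f(m+k)$ for all $n,m,k \geq 0$ for which there is some $l \geq 0$ with $k < q^l$, $q^l \mid m$, $m < q^{l+r}$ and $q^{l+r} \mid n$. -}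

module Defs where

open import Level using (Level)
open import Data.Bool using (Bool; true; false; if_then_else_; _∨_; _∧_)
open import Data.Nat using (ℕ; zero; suc; _+_; _*_; _∸_; _^_; _≤_; _<_)
open import Data.Nat.DivMod using (_/_; _%_)
open import Data.Nat.Divisibility using (_∣_)
open import Data.List using (map; upTo)
open import Data.Nat.ListAction using (sum)
open import Data.Product using (Σ; ∃; _×_)
open import Relation.Binary.PropositionalEquality using (_≡_)
open import Relation.Nullary using (¬_)
open import Algebra.Bundles using (AbelianGroup)

Subset : Set
Subset = ℕ → Bool

-- j-th base-q digit of n (junk value 0 when q = 0; only used for q ≥ 2).
digit : (q j n : ℕ) → ℕ
digit zero    j       n = 0
digit (suc p) zero    n = n % suc p
digit (suc p) (suc j) n = digit (suc p) j (n / suc p)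

-- n|_I = Σ_{j ∈ I} d_j q^j.  For q ≥ 2 all digits at positions j > n vanish,
-- so summing over j < n + 1 is the full sum.
restrict : (q : ℕ) → Subset → ℕ → ℕ
restrict q I n =
  sum (map (λ j → if I j then digit q j n * q ^ j else 0) (upTo (suc n)))

_∪_ : Subset → Subset → Subset
(A ∪ B) j = A j ∨ B j

DisjointUnion3 : Subset → Subset → Subset → Set
DisjointUnion3 I₁ I₂ I₃ =
  ∀ j → ((I₁ j ∨ I₂ j ∨ I₃ j) ≡ true)
      × ¬ ((I₁ j ∧ I₂ j) ≡ true)
      × ¬ ((I₂ j ∧ I₃ j) ≡ true)
      × ¬ ((I₁ j ∧ I₃ j) ≡ true)

UnionOfLongIntervals : ℕ → Subset → Set
UnionOfLongIntervals r I =
  ∀ j → I j ≡ true →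
    Σ ℕ λ a → Σ ℕ λ b →
      (a ≤ j) × (j < b) × (r ≤ b ∸ a) × (∀ i → a ≤ i → i < b → I i ≡ true)

module _ {c ℓ : Level} (G : AbelianGroup c ℓ) where
  open AbelianGroup G

  SM : (q r : ℕ) → (ℕ → Carrier) → Set ℓ
  SM q r f =
    (f 0 ≈ ε) ×
    (∀ n m k →
      (Σ ℕ λ l → (k < q ^ l) × (q ^ l ∣ m) × (m < q ^ (l + r)) × (q ^ (l + r) ∣ n)) →
      f (n + m + k) ≈ (f (n + m) ∙ (f m ⁻¹)) ∙ f (m + k))

-- Write Φ(z) for the right-hand side at z.  If the digits of z avoid one of the three
-- sets, Φ(z) collapses to f(z): the union not meeting the avoided set restricts z to
-- itself, the other two unions restrict it to single sets and cancel against their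
-- inverses, and the restriction to the avoided set is 0, where f(0) = ε.
-- In general, the SM identity applied to the parts of z at positions ≥ l + r, in
-- [l, l + r) and below l gives f(z) = f(z|≥l) f(z|[l,l+r))⁻¹ f(z|<l+r); since
-- restrictions commute and G is abelian, Φ splits in the same way.  Now induct on s,
-- assuming that the digits of z at positions > s all lie in one set I_a.  Position s
-- lies in an interval [u, v) ⊆ I_b with s < v and v - u ≥ r; splitting at the window
-- [u, u + r) leaves two parts whose digits lie in at most two of the sets, and a part
-- below u + r whose digits at positions ≥ s all lie in I_b.

module Submission where

open import Defs
open import Level using (Level)
open import Algebra.Bundles using (AbelianGroup)
open import Function using (_∘_; _$_; id)
open import Data.Bool using (Bool; true; false; if_then_else_; _∨_; _∧_; not)
open import Data.Bool.Properties
  using (∨-identityʳ; ∨-comm; ∨-assoc; ∧-inverseˡ; ∨-inverseˡ; ∧-zeroʳ;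
         if-float; if-eta; if-cong; if-cong-then; if-swap-then)
open import Data.Nat
open import Data.Nat.Properties
open import Data.Nat.DivMod
open import Data.Nat.Divisibility using (_∣_; divides; n∣m*n)
open import Data.List using ([]; _∷_; map; applyUpTo; upTo)
open import Data.List.Properties using (map-cong; map-upTo)
open import Data.Nat.ListAction using (sum)
open import Data.Product using (Σ; _×_; _,_; proj₁; proj₂)
open import Data.Sum as Sum using (_⊎_; inj₁; inj₂; [_,_]′)
open import Data.Empty using (⊥)
open import Relation.Nullary using (yes; no; contradiction)
open import Relation.Nullary.Reflects using (ofʸ; ofⁿ)
open import Relation.Binary.PropositionalEquality
  using (_≡_; _≢_; refl; sym; trans; cong; cong₂; subst; module ≡-Reasoning)

below : ℕ → Subset
below l j = j <ᵇ l

atLeast : ℕ → Subset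
atLeast l j = not (below l j)

between : ℕ → ℕ → Subset
between l s j = atLeast l j ∧ below s j

below-elim : ∀ l j (P : Bool → Set) → (j < l → P true) → (l ≤ j → P false) → P (below l j)
below-elim l j P lt ge with j <ᵇ l | <ᵇ-reflects-< j l
... | true  | ofʸ j<l = lt j<l
... | false | ofⁿ j≮l = ge (≮⇒≥ j≮l)

below-elim₂ : ∀ {l s} → l ≤ s → ∀ j (P : Bool → Bool → Set) →
              P true true → P false true → P false false → P (below l j) (below s j)
below-elim₂ {l} {s} l≤s j P low mid high = below-elim l j (λ a → P a (below s j))
  (λ j<l → below-elim s j (P true) (λ _ → low) (λ s≤j → contradiction (<-≤-trans j<l l≤s) (≤⇒≯ s≤j)))
  (λ _ → below-elim s j (P false) (λ _ → mid) (λ _ → high))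

below-true : ∀ {l j} → j < l → below l j ≡ true
below-true {l} {j} j<l = below-elim l j (_≡ true) (λ _ → refl) (λ l≤j → contradiction j<l (≤⇒≯ l≤j))

below-false : ∀ {l j} → l ≤ j → below l j ≡ false
below-false {l} {j} l≤j = below-elim l j (_≡ false) (λ j<l → contradiction j<l (≤⇒≯ l≤j)) (λ _ → refl)

below⇒< : ∀ l j → below l j ≡ true → j < l
below⇒< l j = below-elim l j (λ b → b ≡ true → j < l) (λ j<l _ → j<l) (λ _ ())

atLeast⇒≤ : ∀ l j → atLeast l j ≡ true → l ≤ j
atLeast⇒≤ l j = below-elim l j (λ b → not b ≡ true → l ≤ j) (λ _ ()) (λ l≤j _ → l≤j)

between⇒∈ : ∀ l s j → between l s j ≡ true → l ≤ j × j < s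
between⇒∈ l s j = below-elim l j (λ a → (not a ∧ below s j) ≡ true → l ≤ j × j < s) (λ _ ())
  (λ l≤j j<s → l≤j , below⇒< s j j<s)

module Digits (p : ℕ) where

  -- Writing q ≥ 2 as 2 + p makes `digit q` compute.
  q : ℕ
  q = 2 + p

  1<q : 1 < q
  1<q = s≤s (s≤s z≤n)

  digit-< : ∀ j n → digit q j n < q
  digit-< zero    n = m%n<n n q
  digit-< (suc j) n = digit-< j (n / q)

  digit-zero : ∀ j → digit q j 0 ≡ 0
  digit-zero zero    = refl
  digit-zero (suc j) = digit-zero j

  digit-<q^ : ∀ j n → n < q ^ j → digit q j n ≡ 0
  digit-<q^ zero    zero    _         = refl
  digit-<q^ zero    (suc n) (s≤s ())
  digit-<q^ (suc j) n       n<q^[1+j] =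
    digit-<q^ j (n / q) (m<n*o⇒m/o<n (subst (n <_) (*-comm q (q ^ j)) n<q^[1+j]))

  n<q^n : ∀ n → n < q ^ n
  n<q^n zero    = s≤s z≤n
  n<q^n (suc n) = ≤-<-trans (n<q^n n) (^-monoʳ-< q 1<q (n<1+n n))

  digit-high : ∀ {j n} → n < j → digit q j n ≡ 0
  digit-high {j} {n} n<j = digit-<q^ j n (<-trans (n<q^n n) (^-monoʳ-< q 1<q n<j))

  [m+kq]%q≡m : ∀ m k → m < q → (m + k * q) % q ≡ m
  [m+kq]%q≡m m k m<q = trans ([m+kn]%n≡m%n m k q) (m<n⇒m%n≡m m<q)

  [m+kq]/q≡k : ∀ m k → m < q → (m + k * q) / q ≡ k
  [m+kq]/q≡k m k m<q =
    trans (+-distrib-/-∣ʳ m (n∣m*n k)) (cong₂ _+_ (m<n⇒m/n≡0 m<q) (m*n/n≡m k q))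

  digits-injective : ∀ {x y} → (∀ j → digit q j x ≡ digit q j y) → x ≡ y
  digits-injective {x} {y} = go (x + y) (m≤m+n x y) (m≤n+m y x)
    where
    /q-≤ : ∀ {x K} → x ≤ suc K → x / q ≤ K
    /q-≤ {zero}  _   = z≤n
    /q-≤ {suc x} x≤K = ≤-pred (<-≤-trans (m/n<m (suc x) q 1<q) x≤K)

    go : ∀ K {x y} → x ≤ K → y ≤ K → (∀ j → digit q j x ≡ digit q j y) → x ≡ y
    go zero    x≤0 y≤0 _ = trans (n≤0⇒n≡0 x≤0) (sym (n≤0⇒n≡0 y≤0))
    go (suc K) {x} {y} x≤K y≤K same = begin
      x                 ≡⟨ m≡m%n+[m/n]*n x q ⟩
      x % q + x / q * q ≡⟨ cong₂ (λ a b → a + b * q) (same 0) (go K (/q-≤ x≤K) (/q-≤ y≤K) (same ∘ suc)) ⟩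
      y % q + y / q * q ≡⟨ sym (m≡m%n+[m/n]*n y q) ⟩
      y                 ∎
      where open ≡-Reasoning

  high-digits-zero⇒<q^ : ∀ l x → (∀ j → l ≤ j → digit q j x ≡ 0) → x < q ^ l
  high-digits-zero⇒<q^ zero x zero-from-0 =
    subst (_< 1) (sym (digits-injective (λ j → trans (zero-from-0 j z≤n) (sym (digit-zero j))))) (s≤s z≤n)
  high-digits-zero⇒<q^ (suc l) x zero-from-1+l = begin-strict
    x                 ≡⟨ m≡m%n+[m/n]*n x q ⟩
    x % q + x / q * q <⟨ +-monoˡ-< (x / q * q) (m%n<n x q) ⟩
    suc (x / q) * q   ≤⟨ *-monoˡ-≤ q (high-digits-zero⇒<q^ l (x / q) (λ j l≤j → zero-from-1+l (suc j) (s≤s l≤j))) ⟩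
    q ^ l * q         ≡⟨ *-comm (q ^ l) q ⟩
    q ^ suc l         ∎
    where open ≤-Reasoning

  low-digits-zero⇒q^∣ : ∀ l x → (∀ j → j < l → digit q j x ≡ 0) → q ^ l ∣ x
  low-digits-zero⇒q^∣ zero    x _ = divides x (sym (*-identityʳ x))
  low-digits-zero⇒q^∣ (suc l) x zero-below-1+l
    with low-digits-zero⇒q^∣ l (x / q) (λ j j<l → zero-below-1+l (suc j) (s≤s j<l))
  ... | divides k x/q≡k*q^l = divides k (begin
    x                 ≡⟨ m≡m%n+[m/n]*n x q ⟩
    x % q + x / q * q ≡⟨ cong₂ (λ a b → a + b * q) (zero-below-1+l 0 (s≤s z≤n)) x/q≡k*q^l ⟩
    k * q ^ l * q     ≡⟨ *-assoc k (q ^ l) q ⟩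
    k * (q ^ l * q)   ≡⟨ cong (k *_) (*-comm (q ^ l) q) ⟩
    k * q ^ suc l     ∎)
    where open ≡-Reasoning

  applyUpTo-cong : ∀ {f g : ℕ → ℕ} → (∀ j → f j ≡ g j) → ∀ K → applyUpTo f K ≡ applyUpTo g K
  applyUpTo-cong f≗g zero    = refl
  applyUpTo-cong f≗g (suc K) = cong₂ _∷_ (f≗g 0) (applyUpTo-cong (f≗g ∘ suc) K)

  sum-applyUpTo-*ʳ : ∀ K (g : ℕ → ℕ) m → sum (applyUpTo (λ j → g j * m) K) ≡ sum (applyUpTo g K) * m
  sum-applyUpTo-*ʳ zero    g m = refl
  sum-applyUpTo-*ʳ (suc K) g m =
    trans (cong (g 0 * m +_) (sum-applyUpTo-*ʳ K (g ∘ suc) m)) (sym (*-distribʳ-+ m (g 0) _))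

  sum-map-+ : ∀ (f g : ℕ → ℕ) xs → sum (map (λ x → f x + g x) xs) ≡ sum (map f xs) + sum (map g xs)
  sum-map-+ f g []       = refl
  sum-map-+ f g (x ∷ xs) =
    trans (cong (f x + g x +_) (sum-map-+ f g xs)) (+-interchange (f x) (g x) _ _)
    where open import Algebra.Properties.CommutativeSemigroup +-commutativeSemigroup
            renaming (interchange to +-interchange)

  expansion : ℕ → (ℕ → ℕ) → ℕ
  expansion K c = sum (applyUpTo (λ j → c j * q ^ j) K)

  expansion-suc : ∀ K c → expansion (suc K) c ≡ c 0 + expansion K (c ∘ suc) * q
  expansion-suc K c = cong₂ _+_ (*-identityʳ (c 0)) (begin
    sum (applyUpTo (λ j → c (suc j) * (q * q ^ j)) K)
      ≡⟨ cong sum (applyUpTo-cong (λ j → *-assoc-comm (c (suc j)) (q ^ j)) K) ⟩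
    sum (applyUpTo (λ j → c (suc j) * q ^ j * q) K)
      ≡⟨ sum-applyUpTo-*ʳ K (λ j → c (suc j) * q ^ j) q ⟩
    expansion K (c ∘ suc) * q ∎)
    where
    open ≡-Reasoning
    *-assoc-comm : ∀ a b → a * (q * b) ≡ a * b * q
    *-assoc-comm a b = trans (cong (a *_) (*-comm q b)) (sym (*-assoc a b q))

  digit-expansion : ∀ K c → (∀ j → c j < q) → (∀ j → K ≤ j → c j ≡ 0) →
                    ∀ j → digit q j (expansion K c) ≡ c j
  digit-expansion zero    c _   vanish j       = trans (digit-zero j) (sym (vanish j z≤n))
  digit-expansion (suc K) c c<q vanish zero    = begin
    expansion (suc K) c % q              ≡⟨ cong (_% q) (expansion-suc K c) ⟩
    (c 0 + expansion K (c ∘ suc) * q) % q ≡⟨ [m+kq]%q≡m (c 0) (expansion K (c ∘ suc)) (c<q 0) ⟩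
    c 0                                  ∎
    where open ≡-Reasoning
  digit-expansion (suc K) c c<q vanish (suc j) = begin
    digit q j (expansion (suc K) c / q)
      ≡⟨ cong (λ x → digit q j (x / q)) (expansion-suc K c) ⟩
    digit q j ((c 0 + expansion K (c ∘ suc) * q) / q)
      ≡⟨ cong (digit q j) ([m+kq]/q≡k (c 0) (expansion K (c ∘ suc)) (c<q 0)) ⟩
    digit q j (expansion K (c ∘ suc))
      ≡⟨ digit-expansion K (c ∘ suc) (c<q ∘ suc) (λ i K≤i → vanish (suc i) (s≤s K≤i)) j ⟩
    c (suc j) ∎
    where open ≡-Reasoning

  Avoids : Subset → ℕ → Set
  Avoids X z = ∀ j → X j ≡ true → digit q j z ≡ 0

  infixl 8 _↾_
  _↾_ : ℕ → Subset → ℕ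
  z ↾ X = restrict q X z

  ↾-expansion : ∀ X z → z ↾ X ≡ expansion (suc z) (λ j → if X j then digit q j z else 0)
  ↾-expansion X z = trans (cong sum (map-upTo _ (suc z)))
    (cong sum (applyUpTo-cong (λ j → sym (if-float (_* q ^ j) (X j) {digit q j z} {0})) (suc z)))

  digit-↾ : ∀ X z j → digit q j (z ↾ X) ≡ (if X j then digit q j z else 0)
  digit-↾ X z j = trans (cong (digit q j) (↾-expansion X z)) (digit-expansion (suc z) _ masked-< masked-high j)
    where
    masked-< : ∀ i → (if X i then digit q i z else 0) < q
    masked-< i with X i
    ... | true  = digit-< i z
    ... | false = s≤s z≤n
    masked-high : ∀ i → suc z ≤ i → (if X i then digit q i z else 0) ≡ 0
    masked-high i z<i = trans (if-cong-then (X i) (digit-high z<i)) (if-eta (X i))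

  ↾-cong : ∀ X Y z → (∀ j → digit q j z ≡ 0 ⊎ X j ≡ Y j) → z ↾ X ≡ z ↾ Y
  ↾-cong X Y z agree = cong sum (map-cong term-agree (upTo (suc z)))
    where
    term : Subset → ℕ → ℕ
    term S j = if S j then digit q j z * q ^ j else 0
    term-vanishes : ∀ S {j} → digit q j z ≡ 0 → term S j ≡ 0
    term-vanishes S {j} dj≡0 = trans (if-cong-then (S j) (cong (_* q ^ j) dj≡0)) (if-eta (S j))
    term-agree : ∀ j → term X j ≡ term Y j
    term-agree j with agree j
    ... | inj₂ Xj≡Yj = if-cong Xj≡Yj
    ... | inj₁ dj≡0  = trans (term-vanishes X dj≡0) (sym (term-vanishes Y dj≡0))

  digit-↾-inside : ∀ X z {j} → X j ≡ true → digit q j (z ↾ X) ≡ digit q j z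
  digit-↾-inside X z {j} Xj = trans (digit-↾ X z j) (cong (λ b → if b then digit q j z else 0) Xj)

  digit-↾-outside : ∀ X z {j} → X j ≡ false → digit q j (z ↾ X) ≡ 0
  digit-↾-outside X z {j} Xj = trans (digit-↾ X z j) (cong (λ b → if b then digit q j z else 0) Xj)

  ↾-supported : ∀ X {P : ℕ → Set} z → (∀ j → X j ≡ true → digit q j z ≡ 0 ⊎ P j) →
                ∀ j → digit q j (z ↾ X) ≡ 0 ⊎ P j
  ↾-supported X z supported j with X j in Xj
  ... | false = inj₁ (digit-↾-outside X z Xj)
  ... | true  = Sum.map₁ (trans (digit-↾-inside X z Xj)) (supported j Xj)

  ↾-all : ∀ z → z ↾ (λ _ → true) ≡ z
  ↾-all z = digits-injective (digit-↾ _ z)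

  ↾-avoiding : ∀ X z → Avoids X z → z ↾ X ≡ 0
  ↾-avoiding X z avoids = digits-injective λ j →
    trans ([ id , (λ ()) ]′ (↾-supported X {λ _ → ⊥} z (λ j Xj → inj₁ (avoids j Xj)) j)) (sym (digit-zero j))

  ↾-comm : ∀ X Y z → z ↾ X ↾ Y ≡ z ↾ Y ↾ X
  ↾-comm X Y z = digits-injective λ j → begin
    digit q j (z ↾ X ↾ Y)                                  ≡⟨ digit-↾ Y (z ↾ X) j ⟩
    (if Y j then digit q j (z ↾ X) else 0)                 ≡⟨ if-cong-then (Y j) (digit-↾ X z j) ⟩
    (if Y j then (if X j then digit q j z else 0) else 0)  ≡⟨ if-swap-then (Y j) (X j) ⟩
    (if X j then (if Y j then digit q j z else 0) else 0)  ≡⟨ sym (if-cong-then (X j) (digit-↾ Y z j)) ⟩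
    (if X j then digit q j (z ↾ Y) else 0)                 ≡⟨ sym (digit-↾ X (z ↾ Y) j) ⟩
    digit q j (z ↾ Y ↾ X)                                  ∎
    where open ≡-Reasoning

  ↾-∪ : ∀ X Y z → (∀ j → (X j ∧ Y j) ≡ false) → z ↾ (X ∪ Y) ≡ z ↾ X + z ↾ Y
  ↾-∪ X Y z disjoint =
    trans (cong sum (map-cong term-split (upTo (suc z)))) (sum-map-+ (term X) (term Y) (upTo (suc z)))
    where
    term : Subset → ℕ → ℕ
    term S j = if S j then digit q j z * q ^ j else 0
    term-split : ∀ j → term (X ∪ Y) j ≡ term X j + term Y j
    term-split j with X j | Y j | disjoint j
    ... | true  | false | _ = sym (+-identityʳ _)
    ... | false | true  | _ = refl
    ... | false | false | _ = refl
    ... | true  | true  | ()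

  ↾-+ : ∀ X Y Z z → (∀ j → (X j ∧ Y j) ≡ false) → (∀ j → (X j ∨ Y j) ≡ Z j) →
        z ↾ X + z ↾ Y ≡ z ↾ Z
  ↾-+ X Y Z z disjoint union = trans (sym (↾-∪ X Y z disjoint)) (↾-cong (X ∪ Y) Z z (inj₂ ∘ union))

  ↾-<q^ : ∀ X l z → (∀ j → l ≤ j → X j ≡ false) → z ↾ X < q ^ l
  ↾-<q^ X l z outside = high-digits-zero⇒<q^ l (z ↾ X) λ j l≤j → digit-↾-outside X z (outside j l≤j)

  q^∣-↾ : ∀ X l z → (∀ j → j < l → X j ≡ false) → q ^ l ∣ z ↾ X
  q^∣-↾ X l z outside = low-digits-zero⇒q^∣ l (z ↾ X) λ j j<l → digit-↾-outside X z (outside j j<l)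

module InclusionExclusion {c ℓ : Level} (G : AbelianGroup c ℓ) where
  open AbelianGroup G renaming (refl to ≈-refl; sym to ≈-sym; trans to ≈-trans)
  open import Algebra.Properties.AbelianGroup G using (⁻¹-∙-comm; ε⁻¹≈ε)
  open import Algebra.Solver.CommutativeMonoid commutativeMonoid using (solve; _⊜_; _⊕_)
  open import Relation.Binary.Reasoning.Setoid setoid

  glue : Carrier → Carrier → Carrier → Carrier
  glue u v w = u ∙ v ⁻¹ ∙ w

  glue-cong : ∀ {u u′ v v′ w w′} → u ≈ u′ → v ≈ v′ → w ≈ w′ → glue u v w ≈ glue u′ v′ w′
  glue-cong u≈u′ v≈v′ w≈w′ = ∙-cong (∙-cong u≈u′ (⁻¹-cong v≈v′)) w≈w′

  glue-∙ : ∀ u v w u′ v′ w′ → glue u v w ∙ glue u′ v′ w′ ≈ glue (u ∙ u′) (v ∙ v′) (w ∙ w′)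
  glue-∙ u v w u′ v′ w′ = begin
    (u ∙ v ⁻¹ ∙ w) ∙ (u′ ∙ v′ ⁻¹ ∙ w′)   ≈⟨ rearrange u (v ⁻¹) w u′ (v′ ⁻¹) w′ ⟩
    (u ∙ u′) ∙ (v ⁻¹ ∙ v′ ⁻¹) ∙ (w ∙ w′) ≈⟨ ∙-congʳ (∙-congˡ (⁻¹-∙-comm v v′)) ⟩
    (u ∙ u′) ∙ (v ∙ v′) ⁻¹ ∙ (w ∙ w′)    ∎
    where
    rearrange : ∀ a b c d e h → (a ∙ b ∙ c) ∙ (d ∙ e ∙ h) ≈ (a ∙ d) ∙ (b ∙ e) ∙ (c ∙ h)
    rearrange = solve 6 (λ a b c d e h → ((a ⊕ b) ⊕ c) ⊕ ((d ⊕ e) ⊕ h) ⊜ ((a ⊕ d) ⊕ (b ⊕ e)) ⊕ (c ⊕ h)) ≈-refl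

  glue-⁻¹ : ∀ u v w → glue u v w ⁻¹ ≈ glue (u ⁻¹) (v ⁻¹) (w ⁻¹)
  glue-⁻¹ u v w = begin
    (u ∙ v ⁻¹ ∙ w) ⁻¹        ≈⟨ ≈-sym (⁻¹-∙-comm (u ∙ v ⁻¹) w) ⟩
    (u ∙ v ⁻¹) ⁻¹ ∙ w ⁻¹     ≈⟨ ∙-congʳ (≈-sym (⁻¹-∙-comm u (v ⁻¹))) ⟩
    u ⁻¹ ∙ v ⁻¹ ⁻¹ ∙ w ⁻¹    ∎

  inclExcl : Carrier → Carrier → Carrier → Carrier → Carrier → Carrier → Carrier
  inclExcl a b c d e h = a ∙ b ∙ c ∙ d ⁻¹ ∙ e ⁻¹ ∙ h ⁻¹

  inclExcl-cong : ∀ {a a′ b b′ c c′ d d′ e e′ h h′} →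
                  a ≈ a′ → b ≈ b′ → c ≈ c′ → d ≈ d′ → e ≈ e′ → h ≈ h′ →
                  inclExcl a b c d e h ≈ inclExcl a′ b′ c′ d′ e′ h′
  inclExcl-cong a≈ b≈ c≈ d≈ e≈ h≈ =
    ∙-cong (∙-cong (∙-cong (∙-cong (∙-cong a≈ b≈) c≈) (⁻¹-cong d≈)) (⁻¹-cong e≈)) (⁻¹-cong h≈)

  inclExcl-rotate : ∀ a b c d e h → inclExcl a b c d e h ≈ inclExcl b c a e h d
  inclExcl-rotate a b c d e h = rotate a b c (d ⁻¹) (e ⁻¹) (h ⁻¹)
    where
    rotate : ∀ a b c d e h → a ∙ b ∙ c ∙ d ∙ e ∙ h ≈ b ∙ c ∙ a ∙ e ∙ h ∙ d
    rotate = solve 6 (λ a b c d e h → ((((a ⊕ b) ⊕ c) ⊕ d) ⊕ e) ⊕ h ⊜ ((((b ⊕ c) ⊕ a) ⊕ e) ⊕ h) ⊕ d) ≈-refl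

  inclExcl-collapse : ∀ x a b → inclExcl x b a a b ε ≈ x
  inclExcl-collapse x a b = begin
    x ∙ b ∙ a ∙ a ⁻¹ ∙ b ⁻¹ ∙ ε ⁻¹     ≈⟨ regroup x b a (a ⁻¹) (b ⁻¹) (ε ⁻¹) ⟩
    x ∙ (a ∙ a ⁻¹) ∙ (b ∙ b ⁻¹) ∙ ε ⁻¹ ≈⟨ ∙-cong (∙-cong (∙-congˡ (inverseʳ a)) (inverseʳ b)) ε⁻¹≈ε ⟩
    x ∙ ε ∙ ε ∙ ε                      ≈⟨ ≈-trans (identityʳ _) (≈-trans (identityʳ _) (identityʳ x)) ⟩
    x                                  ∎
    where
    regroup : ∀ x b a a′ b′ e → x ∙ b ∙ a ∙ a′ ∙ b′ ∙ e ≈ x ∙ (a ∙ a′) ∙ (b ∙ b′) ∙ e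
    regroup = solve 6 (λ x b a a′ b′ e → ((((x ⊕ b) ⊕ a) ⊕ a′) ⊕ b′) ⊕ e ⊜ ((x ⊕ (a ⊕ a′)) ⊕ (b ⊕ b′)) ⊕ e) ≈-refl

  inclExcl-glue : ∀ {a b c d e h u₁ u₂ u₃ u₄ u₅ u₆ v₁ v₂ v₃ v₄ v₅ v₆ w₁ w₂ w₃ w₄ w₅ w₆} →
    a ≈ glue u₁ v₁ w₁ → b ≈ glue u₂ v₂ w₂ → c ≈ glue u₃ v₃ w₃ →
    d ≈ glue u₄ v₄ w₄ → e ≈ glue u₅ v₅ w₅ → h ≈ glue u₆ v₆ w₆ →
    inclExcl a b c d e h ≈
      glue (inclExcl u₁ u₂ u₃ u₄ u₅ u₆) (inclExcl v₁ v₂ v₃ v₄ v₅ v₆) (inclExcl w₁ w₂ w₃ w₄ w₅ w₆)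
  inclExcl-glue a≈ b≈ c≈ d≈ e≈ h≈ = times⁻¹ (times⁻¹ (times⁻¹ (times (times a≈ b≈) c≈) d≈) e≈) h≈
    where
    times : ∀ {x y u v w u′ v′ w′} → x ≈ glue u v w → y ≈ glue u′ v′ w′ →
            x ∙ y ≈ glue (u ∙ u′) (v ∙ v′) (w ∙ w′)
    times x≈ y≈ = ≈-trans (∙-cong x≈ y≈) (glue-∙ _ _ _ _ _ _)
    times⁻¹ : ∀ {x y u v w u′ v′ w′} → x ≈ glue u v w → y ≈ glue u′ v′ w′ →
              x ∙ y ⁻¹ ≈ glue (u ∙ u′ ⁻¹) (v ∙ v′ ⁻¹) (w ∙ w′ ⁻¹)
    times⁻¹ x≈ y≈ = times x≈ (≈-trans (⁻¹-cong y≈) (glue-⁻¹ _ _ _))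

Covers : Subset → Subset → Subset → Set
Covers I J K = ∀ j → (I j ∨ J j ∨ K j) ≡ true

covers-rotate : ∀ I J K → Covers I J K → Covers J K I
covers-rotate I J K covers j = trans (sym (trans (∨-comm (I j) _) (∨-assoc (J j) (K j) (I j)))) (covers j)

data Colour : Set where
  one two three : Colour

other-than : ∀ a b → Σ Colour λ c → c ≢ a × c ≢ b
other-than one   one   = two   , (λ ()) , (λ ())
other-than one   two   = three , (λ ()) , (λ ())
other-than one   three = two   , (λ ()) , (λ ())
other-than two   one   = three , (λ ()) , (λ ())
other-than two   two   = one   , (λ ()) , (λ ())
other-than two   three = one   , (λ ()) , (λ ())
other-than three one   = two   , (λ ()) , (λ ())
other-than three two   = one   , (λ ()) , (λ ())
other-than three three = one   , (λ ()) , (λ ())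

module Splitting {c ℓ : Level} (p r : ℕ) (G : AbelianGroup c ℓ)
                 (f : ℕ → AbelianGroup.Carrier G) (f-sm : SM G (2 + p) r f) where
  open Digits p
  open AbelianGroup G renaming (refl to ≈-refl; sym to ≈-sym; trans to ≈-trans)
  open InclusionExclusion G
  open import Relation.Binary.Reasoning.Setoid setoid

  sm-split : ∀ l z → f z ≈ glue (f (z ↾ atLeast l)) (f (z ↾ between l (l + r))) (f (z ↾ below (l + r)))
  sm-split l z = begin
    f z
      ≡⟨ cong f (sym n+m+k≡z) ⟩
    f (n + m + k)
      ≈⟨ proj₂ f-sm n m k (l , k<q^l , q^l∣m , m<q^s , q^s∣n) ⟩
    glue (f (n + m)) (f m) (f (m + k))
      ≡⟨ cong₂ (λ x y → glue (f x) (f m) (f y)) n+m≡z↾atLeast-l m+k≡z↾below-s ⟩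
    glue (f (z ↾ atLeast l)) (f m) (f (z ↾ below s)) ∎
    where
    s n m k : ℕ
    s = l + r
    n = z ↾ atLeast s
    m = z ↾ between l s
    k = z ↾ below l
    l≤s : l ≤ s
    l≤s = m≤m+n l r
    n+m≡z↾atLeast-l : n + m ≡ z ↾ atLeast l
    n+m≡z↾atLeast-l = ↾-+ (atLeast s) (between l s) (atLeast l) z
      (λ j → below-elim₂ l≤s j (λ a b → (not b ∧ (not a ∧ b)) ≡ false) refl refl refl)
      (λ j → below-elim₂ l≤s j (λ a b → (not b ∨ (not a ∧ b)) ≡ not a) refl refl refl)
    m+k≡z↾below-s : m + k ≡ z ↾ below s
    m+k≡z↾below-s = ↾-+ (between l s) (below l) (below s) z
      (λ j → below-elim₂ l≤s j (λ a b → ((not a ∧ b) ∧ a) ≡ false) refl refl refl)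
      (λ j → below-elim₂ l≤s j (λ a b → ((not a ∧ b) ∨ a) ≡ b) refl refl refl)
    n+m+k≡z : n + m + k ≡ z
    n+m+k≡z = trans (cong (_+ k) n+m≡z↾atLeast-l)
      (trans (↾-+ (atLeast l) (below l) (λ _ → true) z (∧-inverseˡ ∘ below l) (∨-inverseˡ ∘ below l)) (↾-all z))
    k<q^l : k < q ^ l
    k<q^l = ↾-<q^ (below l) l z (λ j → below-false)
    q^l∣m : q ^ l ∣ m
    q^l∣m = q^∣-↾ (between l s) l z (λ j j<l → cong (λ b → not b ∧ below s j) (below-true j<l))
    m<q^s : m < q ^ s
    m<q^s = ↾-<q^ (between l s) s z (λ j s≤j → trans (cong (atLeast l j ∧_) (below-false s≤j)) (∧-zeroʳ _))
    q^s∣n : q ^ s ∣ n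
    q^s∣n = q^∣-↾ (atLeast s) s z (λ j j<s → cong not (below-true j<s))

  Φ : Subset → Subset → Subset → ℕ → Carrier
  Φ I J K z =
    inclExcl (f (z ↾ (I ∪ J))) (f (z ↾ (J ∪ K))) (f (z ↾ (K ∪ I))) (f (z ↾ I)) (f (z ↾ J)) (f (z ↾ K))

  Φ-split : ∀ I J K l z →
    Φ I J K z ≈ glue (Φ I J K (z ↾ atLeast l)) (Φ I J K (z ↾ between l (l + r))) (Φ I J K (z ↾ below (l + r)))
  Φ-split I J K l z = inclExcl-glue (split (I ∪ J)) (split (J ∪ K)) (split (K ∪ I)) (split I) (split J) (split K)
    where
    split : ∀ X → f (z ↾ X) ≈
      glue (f (z ↾ atLeast l ↾ X)) (f (z ↾ between l (l + r) ↾ X)) (f (z ↾ below (l + r) ↾ X))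
    split X = ≈-trans (sm-split l (z ↾ X))
      (glue-cong (commute (atLeast l)) (commute (between l (l + r))) (commute (below (l + r))))
      where
      commute : ∀ Y → f (z ↾ X ↾ Y) ≈ f (z ↾ Y ↾ X)
      commute Y = reflexive (cong f (↾-comm X Y z))

  Φ-rotate : ∀ I J K z → Φ I J K z ≈ Φ J K I z
  Φ-rotate I J K z = inclExcl-rotate _ _ _ _ _ _

  Φ-collapse : ∀ I J K z → Covers I J K → Avoids K z → f z ≈ Φ I J K z
  Φ-collapse I J K z covers avoids = begin
    f z
      ≈⟨ ≈-sym (inclExcl-collapse (f z) (f (z ↾ I)) (f (z ↾ J))) ⟩
    inclExcl (f z) (f (z ↾ J)) (f (z ↾ I)) (f (z ↾ I)) (f (z ↾ J)) ε
      ≈⟨ ≈-sym (inclExcl-cong (f-cong z↾I∪J) (f-cong z↾J∪K) (f-cong z↾K∪I) ≈-refl ≈-refl f[z↾K]≈ε) ⟩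
    Φ I J K z ∎
    where
    f-cong : ∀ {x y} → x ≡ y → f x ≈ f y
    f-cong = reflexive ∘ cong f
    K-digits-zero : ∀ j → digit q j z ≡ 0 ⊎ K j ≡ false
    K-digits-zero j with K j in Kj
    ... | true  = inj₁ (avoids j Kj)
    ... | false = inj₂ refl
    drop-K : ∀ X {j} → K j ≡ false → (X j ∨ K j) ≡ X j
    drop-K X {j} Kj = trans (cong (X j ∨_) Kj) (∨-identityʳ (X j))
    z↾I∪J : z ↾ (I ∪ J) ≡ z
    z↾I∪J = trans (↾-cong (I ∪ J) (λ _ → true) z λ j →
      Sum.map₂ (λ Kj → trans (cong (I j ∨_) (sym (drop-K J Kj))) (covers j)) (K-digits-zero j)) (↾-all z)
    z↾J∪K : z ↾ (J ∪ K) ≡ z ↾ J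
    z↾J∪K = ↾-cong (J ∪ K) J z λ j → Sum.map₂ (drop-K J) (K-digits-zero j)
    z↾K∪I : z ↾ (K ∪ I) ≡ z ↾ I
    z↾K∪I = ↾-cong (K ∪ I) I z λ j → Sum.map₂ (cong (_∨ I j)) (K-digits-zero j)
    f[z↾K]≈ε : f (z ↾ K) ≈ ε
    f[z↾K]≈ε = ≈-trans (f-cong (↾-avoiding K z avoids)) (proj₁ f-sm)

  module _ (I₁ I₂ I₃ : Subset)
           (long₁ : UnionOfLongIntervals r I₁) (long₂ : UnionOfLongIntervals r I₂)
           (long₃ : UnionOfLongIntervals r I₃) (partition : DisjointUnion3 I₁ I₂ I₃) where

    I : Colour → Subset
    I one   = I₁
    I two   = I₂
    I three = I₃

    long : ∀ a → UnionOfLongIntervals r (I a)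
    long one   = long₁
    long two   = long₂
    long three = long₃

    covers : Covers I₁ I₂ I₃
    covers = proj₁ ∘ partition

    colour-of : ∀ j → Σ Colour λ a → I a j ≡ true
    colour-of j with I₁ j in e₁ | I₂ j in e₂ | I₃ j in e₃ | covers j
    ... | true  | _     | _     | _ = one   , e₁
    ... | false | true  | _     | _ = two   , e₂
    ... | false | false | true  | _ = three , e₃

    colour-unique : ∀ a b {j} → I a j ≡ true → I b j ≡ true → a ≡ b
    colour-unique one   one   _ _ = refl
    colour-unique two   two   _ _ = refl
    colour-unique three three _ _ = refl
    colour-unique one   two   {j} h h′ = contradiction (cong₂ _∧_ h h′) (proj₁ (proj₂ (partition j)))
    colour-unique two   one   {j} h h′ = contradiction (cong₂ _∧_ h′ h) (proj₁ (proj₂ (partition j)))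
    colour-unique two   three {j} h h′ = contradiction (cong₂ _∧_ h h′) (proj₁ (proj₂ (proj₂ (partition j))))
    colour-unique three two   {j} h h′ = contradiction (cong₂ _∧_ h′ h) (proj₁ (proj₂ (proj₂ (partition j))))
    colour-unique one   three {j} h h′ = contradiction (cong₂ _∧_ h h′) (proj₂ (proj₂ (proj₂ (partition j))))
    colour-unique three one   {j} h h′ = contradiction (cong₂ _∧_ h′ h) (proj₂ (proj₂ (proj₂ (partition j))))

    f≈Φ-avoiding : ∀ c z → Avoids (I c) z → f z ≈ Φ I₁ I₂ I₃ z
    f≈Φ-avoiding three z avoids = Φ-collapse I₁ I₂ I₃ z covers avoids
    f≈Φ-avoiding one   z avoids =
      ≈-trans (Φ-collapse I₂ I₃ I₁ z (covers-rotate I₁ I₂ I₃ covers) avoids) (≈-sym (Φ-rotate I₁ I₂ I₃ z))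
    f≈Φ-avoiding two   z avoids =
      ≈-trans (Φ-collapse I₃ I₁ I₂ z (covers-rotate I₂ I₃ I₁ (covers-rotate I₁ I₂ I₃ covers)) avoids)
              (≈-sym (≈-trans (Φ-rotate I₁ I₂ I₃ z) (Φ-rotate I₂ I₃ I₁ z)))

    f≈Φ-two-coloured : ∀ a b z → (∀ j → digit q j z ≡ 0 ⊎ I a j ≡ true ⊎ I b j ≡ true) →
                       f z ≈ Φ I₁ I₂ I₃ z
    f≈Φ-two-coloured a b z supported with other-than a b
    ... | c , c≢a , c≢b = f≈Φ-avoiding c z λ j Icj →
      [ id , [ (λ Iaj → contradiction (colour-unique c a Icj Iaj) c≢a)
             , (λ Ibj → contradiction (colour-unique c b Icj Ibj) c≢b) ]′ ]′ (supported j)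

    f≈Φ-monochromatic-above : ∀ s z a → (∀ j → s ≤ j → digit q j z ≡ 0 ⊎ I a j ≡ true) →
                              f z ≈ Φ I₁ I₂ I₃ z
    f≈Φ-monochromatic-above zero    z a supported =
      f≈Φ-two-coloured a a z (λ j → Sum.map₂ inj₁ (supported j z≤n))
    f≈Φ-monochromatic-above (suc s) z a supported with colour-of s
    ... | b , Ibs with long b s Ibs
    ... | u , v , u≤s , s<v , r≤v∸u , Ib-on = begin
      f z
        ≈⟨ sm-split u z ⟩
      glue (f hi) (f mid) (f lo)
        ≈⟨ glue-cong (f≈Φ-two-coloured a b hi hi-supported) (f≈Φ-two-coloured b b mid mid-supported)
                     (f≈Φ-monochromatic-above s lo b lo-supported) ⟩
      glue (Φ I₁ I₂ I₃ hi) (Φ I₁ I₂ I₃ mid) (Φ I₁ I₂ I₃ lo)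
        ≈⟨ ≈-sym (Φ-split I₁ I₂ I₃ u z) ⟩
      Φ I₁ I₂ I₃ z ∎
      where
      t hi mid lo : ℕ
      t = u + r
      hi = z ↾ atLeast u
      mid = z ↾ between u t
      lo = z ↾ below t
      t≤v : t ≤ v
      t≤v = subst (t ≤_) (m+[n∸m]≡n (<⇒≤ (≤-<-trans u≤s s<v))) (+-monoʳ-≤ u r≤v∸u)
      hi-supported : ∀ j → digit q j hi ≡ 0 ⊎ I a j ≡ true ⊎ I b j ≡ true
      hi-supported = ↾-supported (atLeast u) z λ j j≥u → case-v j (atLeast⇒≤ u j j≥u)
        where
        case-v : ∀ j → u ≤ j → digit q j z ≡ 0 ⊎ I a j ≡ true ⊎ I b j ≡ true
        case-v j u≤j with j <? v
        ... | yes j<v = inj₂ (inj₂ (Ib-on j u≤j j<v))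
        ... | no  j≮v = Sum.map₂ inj₁ (supported j (≤-trans s<v (≮⇒≥ j≮v)))
      mid-supported : ∀ j → digit q j mid ≡ 0 ⊎ I b j ≡ true ⊎ I b j ≡ true
      mid-supported = ↾-supported (between u t) z λ j j-mid →
        let u≤j , j<t = between⇒∈ u t j j-mid in inj₂ (inj₁ (Ib-on j u≤j (<-≤-trans j<t t≤v)))
      lo-supported : ∀ j → s ≤ j → digit q j lo ≡ 0 ⊎ I b j ≡ true
      lo-supported j s≤j = Sum.map₂ (_$ s≤j) (↾-supported (below t) {λ i → s ≤ i → I b i ≡ true} z
        (λ i i<t → inj₂ (λ s≤i → Ib-on i (≤-trans u≤s s≤i) (<-≤-trans (below⇒< t i i<t) t≤v))) j)

lemma3p5 : {c ℓ : Level} (q r : ℕ) → 2 ≤ q → (G : AbelianGroup c ℓ) →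
    (I₁ I₂ I₃ : Subset) →
    UnionOfLongIntervals r I₁ → UnionOfLongIntervals r I₂ → UnionOfLongIntervals r I₃ →
    DisjointUnion3 I₁ I₂ I₃ →
    (f : ℕ → AbelianGroup.Carrier G) → SM G q r f →
    (n : ℕ) →
      AbelianGroup._≈_ G (f n)
        (AbelianGroup._∙_ G (AbelianGroup._∙_ G (AbelianGroup._∙_ G (AbelianGroup._∙_ G (AbelianGroup._∙_ G
          (f (restrict q (I₁ ∪ I₂) n))
          (f (restrict q (I₂ ∪ I₃) n)))
          (f (restrict q (I₃ ∪ I₁) n)))
          (AbelianGroup._⁻¹ G (f (restrict q I₁ n))))
          (AbelianGroup._⁻¹ G (f (restrict q I₂ n))))
          (AbelianGroup._⁻¹ G (f (restrict q I₃ n))))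
lemma3p5 .(2 + p) r (s≤s (s≤s {n = p} z≤n)) G I₁ I₂ I₃ long₁ long₂ long₃ partition f f-sm n =
  Splitting.f≈Φ-monochromatic-above p r G f f-sm I₁ I₂ I₃ long₁ long₂ long₃ partition (suc n) n one
    (λ j n<j → inj₁ (Digits.digit-high p n<j))
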